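{- Let $v_2\ge1$, $\mathbf{v}=(12,v_2)$ and $\mathbf{k}=(3,1)$. Then $D(\mathbf{v},\mathbf{k},2)=4v_2$ if $v_2\le4$, $D(\mathbf{v},\mathbf{k},2)=19$ if $v_2\in\{5,6\}$, and $D(\mathbf{v},\mathbf{k},2)=20$ if $v_2\ge7$.
   Context: Let $X_1,X_2$ be disjoint sets with $|X_1|=v_1$, $|X_2|=v_2$. A block is a pair $(B,\{x\})$ with $B$ a $3$-subset of $X_1$ and $x\in X_2$. A $2$-$((v_1,v_2),(3,1),1)$ generalized packing is a family of blocks such that no $2$-subset of $X_1$ is contained in the first coordinate of more than one block, and for each $a\in X_1$, $x\in X_2$ at most one block $(B,\{x\})$ has $a\in B$. $D(\mathbf{v},\mathbf{k},2)$ is the maximum number of blocks in such a generalized packing. -}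

module Defs where

open import Data.Nat using (ℕ; _≤_)
open import Data.Fin using (Fin; _≟_)
open import Data.Fin.Subset using (Subset; ∣_∣; _∈_)
open import Data.Fin.Subset.Properties using (_∈?_)
open import Data.List using (List; length; filter)
open import Data.Product using (Σ; _×_; proj₁; proj₂; ∃)
open import Relation.Binary.PropositionalEquality using (_≡_; _≢_)
open import Relation.Nullary.Decidable using (_×-dec_)

-- A block (B , {x}) : B a 3-subset of X₁ = Fin v₁, x a point of X₂ = Fin v₂.
Block : ℕ → ℕ → Set
Block v₁ v₂ = (Σ (Subset v₁) (λ B → ∣ B ∣ ≡ 3)) × Fin v₂

blk : ∀ {v₁ v₂} → Block v₁ v₂ → Subset v₁
blk b = proj₁ (proj₁ b)

pt : ∀ {v₁ v₂} → Block v₁ v₂ → Fin v₂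
pt b = proj₂ b

-- A family of blocks (a list, so repetitions are counted with multiplicity)
-- is a 2-((v₁,v₂),(3,1),1) generalized packing if
--  * every 2-subset {p,q} of X₁ lies in the first coordinate of at most one block,
--  * for each a ∈ X₁ and x ∈ X₂ at most one block (B,{x}) has a ∈ B.
IsGenPacking : ∀ {v₁ v₂} → List (Block v₁ v₂) → Set
IsGenPacking {v₁} {v₂} bs =
  (∀ (p q : Fin v₁) → p ≢ q →
     length (filter (λ b → (p ∈? blk b) ×-dec (q ∈? blk b)) bs) ≤ 1)
  × (∀ (a : Fin v₁) (x : Fin v₂) →
     length (filter (λ b → (a ∈? blk b) ×-dec (pt b ≟ x)) bs) ≤ 1)

IsD : ℕ → ℕ → ℕ → Set
IsD v₁ v₂ n =
  (∃ λ (bs : List (Block v₁ v₂)) → IsGenPacking bs × length bs ≡ n)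
  × (∀ (bs : List (Block v₁ v₂)) → IsGenPacking bs → length bs ≤ n)

module Submission where

-- Double counting shows that a class (the blocks at one point of X₂) has at
-- most four blocks and that a point of X₁ lies in at most five blocks; hence there are at
-- most 4v and at most 20 blocks.  For v ≤ 6 more is needed: unless two classes are full,
-- there are at most 4 + 3 · 5 = 19 blocks.  If two classes x, y are full and there are 20
-- blocks, the blocks of x and of y are the rows and the columns of a 4 × 4 grid, every point
-- of X₁ occupies its own cell, and after relabelling the columns the empty cells form the
-- diagonal.  Every point then lies in three further blocks, whose cells form transversals
-- of the grid, no two sharing two cells.  That no such system of transversals exists is a
-- finite fact (grid-lemma), established by a refutation procedure proved sound in general
-- (CoverRefutation) and run on this instance.
--
-- Four parallel classes of pairwise compatible triples give 4v blocks for
-- v ≤ 4; three more blocks give 19 blocks over five points, and an explicit packing has 20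
-- blocks over seven points.  These are checked by a decision procedure for packings, and
-- extending X₂ along an injection preserves packings, which covers v = 6 and every v ≥ 7.

open import Defs
open import Data.Bool using (Bool; true; false; _∧_; _∨_; not; T; T?; if_then_else_)
open import Data.Bool.Properties using (∧-conicalˡ; ∧-conicalʳ; ∧-comm; ∧-idem; ∧-identityʳ; ∧-zeroʳ; T-≡)
import Data.Bool.Properties
open import Data.Empty using (⊥; ⊥-elim)
open import Data.Fin as Fin using (Fin; zero; suc; #_; _≟_)
import Data.Fin.Properties as Finₚ
open import Data.Fin.Subset using (Subset; ∣_∣; ⁅_⁆; _∪_; _∩_) renaming (_∈_ to _∈ₛ_)
open import Data.Fin.Subset.Properties using (_∈?_; x∈p∪q⁻; x∈p∪q⁺; x∈⁅x⁆; x∈⁅y⁆⇒x≡y)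
open import Data.List using (List; []; _∷_; _++_; length; lookup; map; filter; filterᵇ; concatMap; allFin)
open import Data.List.Properties using (length-map)
open import Data.List.Membership.Propositional using (_∈_)
open import Data.List.Membership.Propositional.Properties using (∈-lookup; ∈-map⁺; ∈-map⁻; ∈-filter⁻)
open import Data.List.Relation.Unary.All as All using (All; []; _∷_)
open import Data.List.Relation.Unary.AllPairs using ([]; _∷_)
open import Data.List.Relation.Unary.Any as Any using (Any; here; there)
open import Data.List.Relation.Unary.Unique.Propositional using (Unique)
import Data.List.Relation.Unary.Unique.Propositional.Properties as Unique
open import Data.Nat using (ℕ; zero; suc; _+_; _*_; _≤_; z≤n; s≤s; _<ᵇ_; _≤?_; _<?_) renaming (_≟_ to _≟ℕ_)
open import Data.Nat.Properties hiding (_≟_)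
open import Data.Product using (∃; ∃₂; _×_; _,_; proj₁; proj₂)
open import Data.Sum using (_⊎_; inj₁; inj₂)
open import Data.Vec as Vec using ([]; _∷_)
open import Data.Vec.Properties using (lookup⇒[]=; []=⇒lookup; lookup-zipWith)
import Data.Vec.Properties
open import Function using (_∘_)
open import Function.Bundles using (Equivalence; mk⇔)
open import Level using (0ℓ)
open import Relation.Binary.PropositionalEquality
open import Relation.Nullary using (Dec; yes; no; does; ¬?)
open import Relation.Nullary.Decidable using (True; isYes; toWitness; dec-true; dec-false; does-⇔; _×-dec_; _→-dec_)
open import Relation.Unary using (Pred; Decidable)

open import Algebra.Properties.CommutativeSemigroup +-commutativeSemigroup using (interchange)

two≰one : 2 ≤ 1 → ⊥
two≰one (s≤s ())

∧-true : ∀ {a b} → a ∧ b ≡ true → a ≡ true × b ≡ true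
∧-true {a} {b} e = ∧-conicalˡ a b e , ∧-conicalʳ a b e

𝟙 : Bool → ℕ
𝟙 true  = 1
𝟙 false = 0

count : {A : Set} → (A → Bool) → List A → ℕ
count f []       = 0
count f (x ∷ xs) = 𝟙 (f x) + count f xs

𝟙-mono : ∀ {a b} → (a ≡ true → b ≡ true) → 𝟙 a ≤ 𝟙 b
𝟙-mono {false} _ = z≤n
𝟙-mono {true}  h rewrite h refl = ≤-refl

count-mono : ∀ {A : Set} (f g : A → Bool) xs →
  (∀ {x} → x ∈ xs → f x ≡ true → g x ≡ true) → count f xs ≤ count g xs
count-mono f g []       _ = z≤n
count-mono f g (x ∷ xs) h = +-mono-≤ (𝟙-mono (h (here refl))) (count-mono f g xs (h ∘ there))

count-cong : ∀ {A : Set} {f g : A → Bool} → (∀ x → f x ≡ g x) → ∀ xs → count f xs ≡ count g xs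
count-cong f≗g []       = refl
count-cong f≗g (x ∷ xs) = cong₂ _+_ (cong 𝟙 (f≗g x)) (count-cong f≗g xs)

count-false : ∀ {A : Set} (xs : List A) → count (λ _ → false) xs ≡ 0
count-false []       = refl
count-false (x ∷ xs) = count-false xs

count-true : ∀ {A : Set} (xs : List A) → count (λ _ → true) xs ≡ length xs
count-true []       = refl
count-true (x ∷ xs) = cong suc (count-true xs)

count-split : ∀ {A : Set} (g f : A → Bool) xs →
  count f xs ≡ count (λ x → g x ∧ f x) xs + count (λ x → not (g x) ∧ f x) xs
count-split g f []       = refl
count-split g f (x ∷ xs) = begin
  𝟙 (f x) + count f xs
    ≡⟨ cong₂ _+_ (split (g x) (f x)) (count-split g f xs) ⟩
  (𝟙 (g x ∧ f x) + 𝟙 (not (g x) ∧ f x)) + (count (λ y → g y ∧ f y) xs + count (λ y → not (g y) ∧ f y) xs)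
    ≡⟨ interchange (𝟙 (g x ∧ f x)) _ (count (λ y → g y ∧ f y) xs) _ ⟩
  (𝟙 (g x ∧ f x) + count _ xs) + (𝟙 (not (g x) ∧ f x) + count _ xs) ∎
  where
  open ≡-Reasoning
  split : ∀ a b → 𝟙 b ≡ 𝟙 (a ∧ b) + 𝟙 (not a ∧ b)
  split true  b = sym (+-identityʳ (𝟙 b))
  split false b = refl

count-∨ : ∀ {A : Set} (f g : A → Bool) xs → (∀ x → f x ∧ g x ≡ false) →
  count (λ x → f x ∨ g x) xs ≡ count f xs + count g xs
count-∨ f g []       _ = refl
count-∨ f g (x ∷ xs) disjoint = begin
  𝟙 (f x ∨ g x) + count _ xs
    ≡⟨ cong₂ _+_ (disjoint-𝟙 (f x) (g x) (disjoint x)) (count-∨ f g xs disjoint) ⟩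
  (𝟙 (f x) + 𝟙 (g x)) + (count f xs + count g xs)
    ≡⟨ interchange (𝟙 (f x)) (𝟙 (g x)) (count f xs) (count g xs) ⟩
  (𝟙 (f x) + count f xs) + (𝟙 (g x) + count g xs) ∎
  where
  open ≡-Reasoning
  disjoint-𝟙 : ∀ a b → a ∧ b ≡ false → 𝟙 (a ∨ b) ≡ 𝟙 a + 𝟙 b
  disjoint-𝟙 true  true  ()
  disjoint-𝟙 true  false _ = refl
  disjoint-𝟙 false b     _ = refl

count-witness : ∀ {A : Set} (f : A → Bool) xs → 1 ≤ count f xs → ∃ λ x → x ∈ xs × f x ≡ true
count-witness f (x ∷ xs) pos with f x in fx
... | true  = x , here refl , fx
... | false = let (y , y∈ , fy) = count-witness f xs pos in y , there y∈ , fy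

count-witness-at : ∀ {A : Set} (f : A → Bool) xs → 1 ≤ count f xs → ∃ λ (i : Fin (length xs)) → f (lookup xs i) ≡ true
count-witness-at f (x ∷ xs) pos with f x in fx
... | true  = zero , fx
... | false = let (i , fi) = count-witness-at f xs pos in suc i , fi

count-filterᵇ : ∀ {A : Set} (p f : A → Bool) xs → count f (filterᵇ p xs) ≡ count (λ x → f x ∧ p x) xs
count-filterᵇ p f []       = refl
count-filterᵇ p f (x ∷ xs) with p x
... | true  = cong₂ _+_ (cong 𝟙 (sym (∧-identityʳ (f x)))) (count-filterᵇ p f xs)
... | false = trans (count-filterᵇ p f xs) (cong (_+ count (λ y → f y ∧ p y) xs) (cong 𝟙 (sym (∧-zeroʳ (f x)))))

count-two-at : ∀ {A : Set} (f : A → Bool) xs (i j : Fin (length xs)) → i ≢ j →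
  f (lookup xs i) ≡ true → f (lookup xs j) ≡ true → 2 ≤ count f xs
count-two-at f (x ∷ xs) zero    zero    i≢j _  _  = ⊥-elim (i≢j refl)
count-two-at f (x ∷ xs) zero    (suc j) _   fi fj rewrite fi = s≤s (count-positive f xs j fj)
  where
  count-positive : ∀ {A : Set} (f : A → Bool) xs (j : Fin (length xs)) → f (lookup xs j) ≡ true → 1 ≤ count f xs
  count-positive f (y ∷ ys) zero    fj rewrite fj = s≤s z≤n
  count-positive f (y ∷ ys) (suc j) fj = ≤-trans (count-positive f ys j fj) (m≤n+m _ (𝟙 (f y)))
count-two-at f (x ∷ xs) (suc i) zero    i≢j fi fj = count-two-at f (x ∷ xs) zero (suc i) (i≢j ∘ sym) fj fi
count-two-at f (x ∷ xs) (suc i) (suc j) i≢j fi fj =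
  ≤-trans (count-two-at f xs i j (i≢j ∘ cong suc) fi fj) (m≤n+m _ (𝟙 (f x)))

count-two : ∀ {A : Set} (f : A → Bool) xs {x y} → x ∈ xs → y ∈ xs → x ≢ y →
  f x ≡ true → f y ≡ true → 2 ≤ count f xs
count-two f xs x∈ y∈ x≢y fx fy =
  count-two-at f xs (Any.index x∈) (Any.index y∈)
    (λ same → x≢y (trans (lookup-index x∈) (trans (cong (lookup xs) same) (sym (lookup-index y∈)))))
    (subst (λ z → f z ≡ true) (lookup-index x∈) fx) (subst (λ z → f z ≡ true) (lookup-index y∈) fy)
  where
  lookup-index : ∀ {A : Set} {xs : List A} {x} (x∈ : x ∈ xs) → x ≡ lookup xs (Any.index x∈)
  lookup-index (here refl) = refl
  lookup-index (there x∈)  = lookup-index x∈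

count-map : ∀ {A B : Set} (f : B → Bool) (g : A → B) xs → count f (map g xs) ≡ count (f ∘ g) xs
count-map f g []       = refl
count-map f g (x ∷ xs) = cong (𝟙 (f (g x)) +_) (count-map f g xs)

sumOver : {A : Set} → (A → ℕ) → List A → ℕ
sumOver w []       = 0
sumOver w (x ∷ xs) = w x + sumOver w xs

sumOver-+ : ∀ {A : Set} (v w : A → ℕ) xs → sumOver (λ t → v t + w t) xs ≡ sumOver v xs + sumOver w xs
sumOver-+ v w []       = refl
sumOver-+ v w (t ∷ ts) = trans (cong (v t + w t +_) (sumOver-+ v w ts)) (interchange (v t) (w t) (sumOver v ts) (sumOver w ts))

count≤sumOver : ∀ {A T : Set} (f : A → Bool) (g : T → A → Bool) ts xs →
  (∀ {x} → x ∈ xs → f x ≡ true → Any (λ t → g t x ≡ true) ts) →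
  count f xs ≤ sumOver (λ t → count (g t) xs) ts
count≤sumOver f g ts []       covered = z≤n
count≤sumOver f g ts (x ∷ xs) covered = begin
  𝟙 (f x) + count f xs
    ≤⟨ +-mono-≤ (head (f x) refl) (count≤sumOver f g ts xs (covered ∘ there)) ⟩
  sumOver (λ t → 𝟙 (g t x)) ts + sumOver (λ t → count (g t) xs) ts
    ≡⟨ sym (sumOver-+ (λ t → 𝟙 (g t x)) (λ t → count (g t) xs) ts) ⟩
  sumOver (λ t → 𝟙 (g t x) + count (g t) xs) ts ∎
  where
  open ≤-Reasoning
  hit : ∀ {us} → Any (λ t → g t x ≡ true) us → 1 ≤ sumOver (λ t → 𝟙 (g t x)) us
  hit {t ∷ _}  (here gt) rewrite gt = s≤s z≤n
  hit {t ∷ us} (there h) = ≤-trans (hit h) (m≤n+m _ (𝟙 (g t x)))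
  head : ∀ b → f x ≡ b → 𝟙 b ≤ sumOver (λ t → 𝟙 (g t x)) ts
  head false _  = z≤n
  head true  fx = hit (covered (here refl) fx)

sumOver-cong : ∀ {A : Set} {v w : A → ℕ} → (∀ t → v t ≡ w t) → ∀ ts → sumOver v ts ≡ sumOver w ts
sumOver-cong v≗w []       = refl
sumOver-cong v≗w (t ∷ ts) = cong₂ _+_ (v≗w t) (sumOver-cong v≗w ts)

∑ : (n : ℕ) → (Fin n → ℕ) → ℕ
∑ zero    f = 0
∑ (suc n) f = f zero + ∑ n (f ∘ suc)

∑-cong : ∀ n {f g : Fin n → ℕ} → (∀ i → f i ≡ g i) → ∑ n f ≡ ∑ n g
∑-cong zero    _ = refl
∑-cong (suc n) h = cong₂ _+_ (h zero) (∑-cong n (h ∘ suc))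

∑-mono : ∀ n {f g : Fin n → ℕ} → (∀ i → f i ≤ g i) → ∑ n f ≤ ∑ n g
∑-mono zero    _ = z≤n
∑-mono (suc n) h = +-mono-≤ (h zero) (∑-mono n (h ∘ suc))

∑-const : ∀ n m → ∑ n (λ _ → m) ≡ n * m
∑-const zero    m = refl
∑-const (suc n) m = cong (m +_) (∑-const n m)

∑-zero : ∀ n → ∑ n (λ _ → 0) ≡ 0
∑-zero n = trans (∑-const n 0) (*-zeroʳ n)

∑-+ : ∀ n (f g : Fin n → ℕ) → ∑ n (λ i → f i + g i) ≡ ∑ n f + ∑ n g
∑-+ zero    f g = refl
∑-+ (suc n) f g = trans (cong (f zero + g zero +_) (∑-+ n (f ∘ suc) (g ∘ suc)))
                        (interchange (f zero) (g zero) (∑ n (f ∘ suc)) (∑ n (g ∘ suc)))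

∑-saturated : ∀ n (f : Fin n → ℕ) m → (∀ i → f i ≤ m) → n * m ≤ ∑ n f → ∀ i → f i ≡ m
∑-saturated (suc n) f m bound full i = at i
  where
  rest≤ : ∑ n (f ∘ suc) ≤ n * m
  rest≤ = ≤-trans (∑-mono n (bound ∘ suc)) (≤-reflexive (∑-const n m))
  head≡ : f zero ≡ m
  head≡ = ≤-antisym (bound zero) (+-cancelʳ-≤ (n * m) m (f zero) (≤-trans full (+-monoʳ-≤ (f zero) rest≤)))
  rest-full : n * m ≤ ∑ n (f ∘ suc)
  rest-full = +-cancelˡ-≤ m _ _ (≤-trans full (+-monoˡ-≤ _ (bound zero)))
  at : ∀ i → f i ≡ m
  at zero    = head≡
  at (suc i) = ∑-saturated n (f ∘ suc) m (bound ∘ suc) rest-full i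

∑-except : ∀ n (f : Fin (suc n) → ℕ) a → (∀ i → i ≢ a → f i ≤ 1) → ∑ (suc n) f ≤ f a + n
∑-except n f zero small =
  +-monoʳ-≤ (f zero) (≤-trans (∑-mono n (λ i → small (suc i) (λ ()))) (≤-reflexive (trans (∑-const n 1) (*-identityʳ n))))
∑-except (suc n) f (suc a) small = begin
  f zero + ∑ (suc n) (f ∘ suc)  ≤⟨ +-mono-≤ (small zero (λ ())) (∑-except n (f ∘ suc) a (λ i i≢a → small (suc i) (i≢a ∘ Finₚ.suc-injective))) ⟩
  1 + (f (suc a) + n)            ≡⟨ sym (+-suc (f (suc a)) n) ⟩
  f (suc a) + suc n              ∎
  where open ≤-Reasoning

∑-one-full : ∀ n (f : Fin n → ℕ) m → (∀ i → f i ≤ suc m) →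
  ∑ n f ≤ n * m + 1 ⊎ ∃₂ λ i j → i ≢ j × f i ≡ suc m × f j ≡ suc m
∑-one-full zero    f m bound = inj₁ z≤n
∑-one-full (suc n) f m bound with ∑-one-full n (f ∘ suc) m (bound ∘ suc)
... | inj₂ (i , j , i≢j , fi , fj) = inj₂ (suc i , suc j , i≢j ∘ Finₚ.suc-injective , fi , fj)
... | inj₁ rest with f zero ≟ℕ suc m
...   | no  head≢ = inj₁ (≤-trans (+-mono-≤ (≤-pred (≤∧≢⇒< (bound zero) head≢)) rest) (≤-reflexive (sym (+-assoc m (n * m) 1))))
...   | yes head≡ with Finₚ.any? (λ k → f (suc k) ≟ℕ suc m)
...     | yes (k , fk) = inj₂ (zero , suc k , (λ ()) , head≡ , fk)
...     | no  none     = inj₁ (begin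
  f zero + ∑ n (f ∘ suc)  ≤⟨ +-mono-≤ (≤-reflexive head≡) (∑-mono n others) ⟩
  suc m + ∑ n (λ _ → m)   ≡⟨ cong (suc m +_) (∑-const n m) ⟩
  suc (m + n * m)         ≡⟨ +-comm 1 (m + n * m) ⟩
  m + n * m + 1           ∎)
  where
  open ≤-Reasoning
  others : ∀ k → f (suc k) ≤ m
  others k = ≤-pred (≤∧≢⇒< (bound (suc k)) (λ e → none (k , e)))

double-counting : ∀ {A : Set} n (inc : A → Fin n → Bool) k → (∀ x → ∑ n (𝟙 ∘ inc x) ≡ k) →
  ∀ (g : A → Bool) xs → ∑ n (λ i → count (λ x → inc x i ∧ g x) xs) ≡ k * count g xs
double-counting n inc k regular g []       = trans (∑-zero n) (sym (*-zeroʳ k))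
double-counting n inc k regular g (x ∷ xs) = begin
  ∑ n (λ i → 𝟙 (inc x i ∧ g x) + count (λ y → inc y i ∧ g y) xs)
    ≡⟨ ∑-+ n _ _ ⟩
  ∑ n (λ i → 𝟙 (inc x i ∧ g x)) + ∑ n (λ i → count (λ y → inc y i ∧ g y) xs)
    ≡⟨ cong₂ _+_ (incidences (g x)) (double-counting n inc k regular g xs) ⟩
  k * 𝟙 (g x) + k * count g xs
    ≡⟨ sym (*-distribˡ-+ k (𝟙 (g x)) (count g xs)) ⟩
  k * (𝟙 (g x) + count g xs) ∎
  where
  open ≡-Reasoning
  incidences : ∀ b → ∑ n (λ i → 𝟙 (inc x i ∧ b)) ≡ k * 𝟙 b
  incidences true  = trans (∑-cong n (λ i → cong 𝟙 (∧-identityʳ (inc x i)))) (trans (regular x) (sym (*-identityʳ k)))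
  incidences false = trans (∑-cong n (λ i → cong 𝟙 (∧-zeroʳ (inc x i)))) (trans (∑-zero n) (sym (*-zeroʳ k)))

elements : ∀ {n} → Subset n → List (Fin n)
elements []          = []
elements (true ∷ p)  = zero ∷ map suc (elements p)
elements (false ∷ p) = map suc (elements p)

length-elements : ∀ {n} (p : Subset n) → length (elements p) ≡ ∣ p ∣
length-elements []          = refl
length-elements (true ∷ p)  = cong suc (trans (length-map suc (elements p)) (length-elements p))
length-elements (false ∷ p) = trans (length-map suc (elements p)) (length-elements p)

elements-sound : ∀ {n} (p : Subset n) {i} → i ∈ elements p → Vec.lookup p i ≡ true
elements-sound (true ∷ p)  (here refl) = refl
elements-sound (true ∷ p)  (there i∈)  with ∈-map⁻ suc i∈
... | j , j∈ , refl = elements-sound p j∈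
elements-sound (false ∷ p) i∈          with ∈-map⁻ suc i∈
... | j , j∈ , refl = elements-sound p j∈

elements-complete : ∀ {n} (p : Subset n) i → Vec.lookup p i ≡ true → i ∈ elements p
elements-complete (true ∷ p)  zero    _  = here refl
elements-complete (true ∷ p)  (suc i) pi = there (∈-map⁺ suc (elements-complete p i pi))
elements-complete (false ∷ p) (suc i) pi = ∈-map⁺ suc (elements-complete p i pi)

elements-unique : ∀ {n} (p : Subset n) → Unique (elements p)
elements-unique []          = []
elements-unique (true ∷ p)  =
  All.tabulate (λ i∈ → let (j , _ , eq) = ∈-map⁻ suc i∈ in λ zero≡ → 0≢suc (trans zero≡ eq))
  ∷ Unique.map⁺ Finₚ.suc-injective (elements-unique p)
  where
  0≢suc : ∀ {n} {j : Fin n} → zero ≢ suc j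
  0≢suc ()
elements-unique (false ∷ p) = Unique.map⁺ Finₚ.suc-injective (elements-unique p)

two-members : ∀ {n} (p : Subset n) → 2 ≤ ∣ p ∣ →
  ∃₂ λ i j → i ≢ j × Vec.lookup p i ≡ true × Vec.lookup p j ≡ true
two-members p big
  with elements p | subst (2 ≤_) (sym (length-elements p)) big | elements-unique p | elements-sound p
... | i ∷ j ∷ _ | _ | (i≢j ∷ _) ∷ _ | sound = i , j , i≢j , sound (here refl) , sound (there (here refl))
... | []        | () | _ | _
... | _ ∷ []    | s≤s () | _ | _

record ThreeElements {n} (p : Subset n) : Set where
  field
    p₁ p₂ p₃ : Fin n
    p₁≢p₂    : p₁ ≢ p₂
    p₁≢p₃    : p₁ ≢ p₃
    p₂≢p₃    : p₂ ≢ p₃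
    p₁∈      : Vec.lookup p p₁ ≡ true
    p₂∈      : Vec.lookup p p₂ ≡ true
    p₃∈      : Vec.lookup p p₃ ≡ true
    only     : ∀ i → Vec.lookup p i ≡ true → i ≡ p₁ ⊎ i ≡ p₂ ⊎ i ≡ p₃

three-elements : ∀ {n} (p : Subset n) → ∣ p ∣ ≡ 3 → ThreeElements p
three-elements p three
  with elements p | trans (length-elements p) three | elements-unique p | elements-sound p | elements-complete p
... | u ∷ v ∷ w ∷ [] | _ | (u≢v ∷ u≢w ∷ []) ∷ (v≢w ∷ []) ∷ [] ∷ [] | sound | complete = record
  { p₁ = u ; p₂ = v ; p₃ = w ; p₁≢p₂ = u≢v ; p₁≢p₃ = u≢w ; p₂≢p₃ = v≢w
  ; p₁∈ = sound (here refl) ; p₂∈ = sound (there (here refl)) ; p₃∈ = sound (there (there (here refl)))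
  ; only = λ i pi → which (complete i pi) }
  where
  which : ∀ {i} → i ∈ u ∷ v ∷ w ∷ [] → i ≡ u ⊎ i ≡ v ⊎ i ≡ w
  which (here i≡u)                 = inj₁ i≡u
  which (there (here i≡v))         = inj₂ (inj₁ i≡v)
  which (there (there (here i≡w))) = inj₂ (inj₂ i≡w)
... | []                    | () | _ | _ | _
... | _ ∷ []                | () | _ | _ | _
... | _ ∷ _ ∷ []            | () | _ | _ | _
... | _ ∷ _ ∷ _ ∷ _ ∷ _     | () | _ | _ | _

triple : ∀ {n} → Fin n → Fin n → Fin n → Subset n
triple a b c = ⁅ a ⁆ ∪ ⁅ b ⁆ ∪ ⁅ c ⁆

triple-members : ∀ {n} (a b c i : Fin n) → Vec.lookup (triple a b c) i ≡ true → i ≡ a ⊎ i ≡ b ⊎ i ≡ c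
triple-members a b c i i∈ with x∈p∪q⁻ ⁅ a ⁆ (⁅ b ⁆ ∪ ⁅ c ⁆) (lookup⇒[]= i _ i∈)
... | inj₁ i∈a = inj₁ (x∈⁅y⁆⇒x≡y a i∈a)
... | inj₂ i∈bc with x∈p∪q⁻ ⁅ b ⁆ ⁅ c ⁆ i∈bc
...   | inj₁ i∈b = inj₂ (inj₁ (x∈⁅y⁆⇒x≡y b i∈b))
...   | inj₂ i∈c = inj₂ (inj₂ (x∈⁅y⁆⇒x≡y c i∈c))

triple-∋ : ∀ {n} (a b c i : Fin n) → i ≡ a ⊎ i ≡ b ⊎ i ≡ c → Vec.lookup (triple a b c) i ≡ true
triple-∋ a b c i which = []=⇒lookup (x∈p∪q⁺ (member which))
  where
  member : i ≡ a ⊎ i ≡ b ⊎ i ≡ c → i ∈ₛ ⁅ a ⁆ ⊎ i ∈ₛ ⁅ b ⁆ ∪ ⁅ c ⁆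
  member (inj₁ refl)        = inj₁ (x∈⁅x⁆ i)
  member (inj₂ (inj₁ refl)) = inj₂ (x∈p∪q⁺ (inj₁ (x∈⁅x⁆ i)))
  member (inj₂ (inj₂ refl)) = inj₂ (x∈p∪q⁺ (inj₂ (x∈⁅x⁆ i)))

injective⇒onto : ∀ {n} (f : Fin n → Fin n) → (∀ {a b} → f a ≡ f b → a ≡ b) → ∀ k → ∃ λ a → f a ≡ k
injective⇒onto {suc n} f injective k with Finₚ.any? (λ a → f a Fin.≟ k)
... | yes hit  = hit
... | no  miss = ⊥-elim (collision (Finₚ.pigeonhole (n<1+n n) squeeze))
  where
  squeeze : Fin (suc n) → Fin n
  squeeze a = Fin.punchOut {i = k} {j = f a} (λ k≡fa → miss (a , sym k≡fa))
  collision : ∃₂ (λ i j → i Fin.< j × squeeze i ≡ squeeze j) → ⊥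
  collision (i , j , i<j , same) = Finₚ.<-irrefl (injective (Finₚ.punchOut-injective {i = k} (λ e → miss (i , sym e)) (λ e → miss (j , sym e)) same)) i<j

-- Candidates τ : A cover some of the
-- cells Fin m; some pairs of candidates conflict.  A valuation c : A → ℕ with values ≤ 1
-- in which conflicting candidates are never both used, and which covers every cell at
-- least `demand` times by the candidates of a family, cannot exist when `refute` accepts
-- the family.  The procedure branches on the candidates in order (use it or not), removes
-- the candidates conflicting with a used one, and prunes as soon as some cell cannot be
-- covered often enough by the used and the remaining candidates.
module CoverRefutation {A : Set} {m : ℕ} (_∋_ : A → Fin m → Bool)
                       (conflict : A → A → Bool) (demand : ℕ) where

  deficient : List A → List A → Bool
  deficient used rest = isYes (Finₚ.any? λ k → count (_∋ k) used + count (_∋ k) rest <? demand)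

  -- refute fuel used rest: every extension of `used` by candidates from `rest` is deficient.
  refute : ℕ → List A → List A → Bool
  refute zero    used rest       = deficient used rest
  refute (suc f) used []         = deficient used []
  refute (suc f) used (τ ∷ rest) =
    deficient used (τ ∷ rest) ∨ (refute f used rest ∧ refute f (τ ∷ used) (filterᵇ (not ∘ conflict τ) rest))

  weight : (A → ℕ) → Fin m → List A → ℕ
  weight c k = sumOver λ τ → if τ ∋ k then c τ else 0

  module Soundness (c : A → ℕ) (c≤1 : ∀ τ → c τ ≤ 1)
                   (exclusive : ∀ τ τ' → conflict τ τ' ≡ true → c τ + c τ' ≤ 1) where

    weight≤count : ∀ k L → weight c k L ≤ count (_∋ k) L
    weight≤count k []      = z≤n
    weight≤count k (τ ∷ L) = +-mono-≤ (term (τ ∋ k)) (weight≤count k L)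
      where
      term : ∀ b → (if b then c τ else 0) ≤ 𝟙 b
      term true  = c≤1 τ
      term false = z≤n

    -- Candidates conflicting with a used candidate carry no weight.
    weight-filter : ∀ τ → c τ ≡ 1 → ∀ k L → weight c k (filterᵇ (not ∘ conflict τ) L) ≡ weight c k L
    weight-filter τ used k []       = refl
    weight-filter τ used k (σ ∷ L) with conflict τ σ in clash
    ... | false = cong (_ +_) (weight-filter τ used k L)
    ... | true  = trans (weight-filter τ used k L) (cong (_+ weight c k L) (sym (unweighted (σ ∋ k))))
      where
      c-σ≡0 : c σ ≡ 0
      c-σ≡0 = n≤0⇒n≡0 (+-cancelˡ-≤ 1 (c σ) 0 (subst (λ t → t + c σ ≤ 1) used (exclusive τ σ clash)))
      unweighted : ∀ b → (if b then c σ else 0) ≡ 0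
      unweighted true  = c-σ≡0
      unweighted false = refl

    -- The invariant of the search: the used candidates (all valued 1) together with the
    -- weight of the remaining ones meet the demand of every cell.
    Covered : List A → List A → Set
    Covered used rest = ∀ k → demand ≤ count (_∋ k) used + weight c k rest

    covered⇒¬deficient : ∀ used rest → Covered used rest → deficient used rest ≡ true → ⊥
    covered⇒¬deficient used rest covered d =
      let (k , short) = toWitness {a? = Finₚ.any? λ k → count (_∋ k) used + count (_∋ k) rest <? demand} (subst T (sym d) _)
      in <⇒≱ short (≤-trans (covered k) (+-monoʳ-≤ (count (_∋ k) used) (weight≤count k rest)))

    -- Branching on c τ = 0 or c τ = 1 preserves the invariant, which no deficient state meets.
    refute-sound : ∀ fuel used rest → Covered used rest → refute fuel used rest ≡ true → ⊥
    refute-sound zero    used rest       covered r = covered⇒¬deficient used rest covered r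
    refute-sound (suc f) used []         covered r = covered⇒¬deficient used [] covered r
    refute-sound (suc f) used (τ ∷ rest) covered r with deficient used (τ ∷ rest) in d
    ... | true  = covered⇒¬deficient used (τ ∷ rest) covered d
    ... | false with c τ in cτ | c≤1 τ
    ...   | zero  | _ = refute-sound f used rest skip (∧-conicalˡ _ _ r)
      where
      skip : Covered used rest
      skip k = subst (λ t → demand ≤ count (_∋ k) used + t) (dropped (τ ∋ k)) (covered k)
        where
        dropped : ∀ b → (if b then 0 else 0) + weight c k rest ≡ weight c k rest
        dropped true  = refl
        dropped false = refl
    ...   | suc zero | _ = refute-sound f (τ ∷ used) _ take (∧-conicalʳ _ _ r)
      where
      take : Covered (τ ∷ used) (filterᵇ (not ∘ conflict τ) rest)
      take k rewrite weight-filter τ cτ k rest | +-assoc (𝟙 (τ ∋ k)) (count (_∋ k) used) (weight c k rest) =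
        ≤-trans (covered k) (moved (τ ∋ k))
        where
        moved : ∀ b → count (_∋ k) used + ((if b then 1 else 0) + weight c k rest) ≤ 𝟙 b + (count (_∋ k) used + weight c k rest)
        moved true  = ≤-reflexive (+-suc _ _)
        moved false = ≤-refl
    ...   | suc (suc _) | s≤s ()

    refutation : ∀ fuel family → (∀ k → demand ≤ weight c k family) → refute fuel [] family ≡ true → ⊥
    refutation fuel family demanded = refute-sound fuel [] family demanded

_≟ˢ_ : (τ τ' : Subset 12) → Dec (τ ≡ τ')
_≟ˢ_ = Data.Vec.Properties.≡-dec Data.Bool.Properties._≟_

open import Data.List.Membership.DecPropositional _≟ˢ_ using () renaming (_∈?_ to _∈-list?_)

-- The twelve off-diagonal cells (r , c), r ≢ c, of a 4 × 4 grid, numbered row by row.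
-- The finite facts about them below are decided exhaustively and kept opaque.
row col : Fin 12 → Fin 4
row k = Vec.lookup (# 0 ∷ # 0 ∷ # 0 ∷ # 1 ∷ # 1 ∷ # 1 ∷ # 2 ∷ # 2 ∷ # 2 ∷ # 3 ∷ # 3 ∷ # 3 ∷ []) k
col k = Vec.lookup (# 1 ∷ # 2 ∷ # 3 ∷ # 0 ∷ # 2 ∷ # 3 ∷ # 0 ∷ # 1 ∷ # 3 ∷ # 0 ∷ # 1 ∷ # 2 ∷ []) k

-- The cell in row r and column c (for r ≢ c).
cellAt : Fin 4 → Fin 4 → Fin 12
cellAt r c = Vec.lookup (Vec.lookup ((# 0 ∷ # 0 ∷ # 1 ∷ # 2 ∷ []) ∷ (# 3 ∷ # 3 ∷ # 4 ∷ # 5 ∷ []) ∷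
                             (# 6 ∷ # 7 ∷ # 6 ∷ # 8 ∷ []) ∷ (# 9 ∷ # 10 ∷ # 11 ∷ # 9 ∷ []) ∷ []) r) c

opaque
  cellAt-row-col : ∀ r c → r ≢ c → row (cellAt r c) ≡ r × col (cellAt r c) ≡ c
  cellAt-row-col = toWitness {a? = Finₚ.all? λ r → Finₚ.all? λ c → ¬? (r ≟ c) →-dec ((row (cellAt r c) ≟ r) ×-dec (col (cellAt r c) ≟ c))} _

opaque
  avoid : (a b c : Fin 4) → ∃ λ d → d ≢ a × d ≢ b × d ≢ c
  avoid = toWitness {a? = Finₚ.all? λ a → Finₚ.all? λ b → Finₚ.all? λ c → Finₚ.any? λ d → ¬? (d ≟ a) ×-dec ¬? (d ≟ b) ×-dec ¬? (d ≟ c)} _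

opaque
  no-three-avoiding-two : ∀ (a b c j j' : Fin 4) → a ≢ b → a ≢ c → b ≢ c → j ≢ j' →
    a ≢ j → b ≢ j → c ≢ j → a ≢ j' → b ≢ j' → c ≢ j' → ⊥
  no-three-avoiding-two = toWitness {a? = Finₚ.all? λ a → Finₚ.all? λ b → Finₚ.all? λ c → Finₚ.all? λ j → Finₚ.all? λ j' →
    ¬? (a ≟ b) →-dec ¬? (a ≟ c) →-dec ¬? (b ≟ c) →-dec ¬? (j ≟ j') →-dec
    ¬? (a ≟ j) →-dec ¬? (b ≟ j) →-dec ¬? (c ≟ j) →-dec ¬? (a ≟ j') →-dec ¬? (b ≟ j') →-dec ¬? (c ≟ j') →-dec no λ ()} _

Transversal : Fin 12 → Fin 12 → Fin 12 → Set
Transversal a b c = (row a ≢ row b × row a ≢ row c × row b ≢ row c)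
                  × (col a ≢ col b × col a ≢ col c × col b ≢ col c)

transversal? : ∀ a b c → Dec (Transversal a b c)
transversal? a b c = (¬? (row a ≟ row b) ×-dec ¬? (row a ≟ row c) ×-dec ¬? (row b ≟ row c))
                ×-dec (¬? (col a ≟ col b) ×-dec ¬? (col a ≟ col c) ×-dec ¬? (col b ≟ col c))

transversals : List (Subset 12)
transversals = concatMap (λ a → concatMap (λ b → concatMap (λ c → select a b c) (allFin 12)) (allFin 12)) (allFin 12)
  where
  select : Fin 12 → Fin 12 → Fin 12 → List (Subset 12)
  select a b c = if isYes (Fin._<?_ a b) ∧ isYes (Fin._<?_ b c) ∧ isYes (transversal? a b c)
                 then triple a b c ∷ [] else []

opaque
  transversal-listed : ∀ a b c → Transversal a b c → triple a b c ∈ transversals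
  transversal-listed = toWitness {a? = Finₚ.all? λ a → Finₚ.all? λ b → Finₚ.all? λ c → transversal? a b c →-dec (triple a b c ∈-list? transversals)} _

conflict : Subset 12 → Subset 12 → Bool
conflict τ τ' = not (isYes (τ ≟ˢ τ')) ∧ (1 <ᵇ ∣ τ ∩ τ' ∣)

open CoverRefutation Vec.lookup conflict 3 using (weight; module Soundness)

grid-lemma : (c : Subset 12 → ℕ) → (∀ τ → c τ ≤ 1) →
  (∀ τ τ' → τ ≢ τ' → 2 ≤ ∣ τ ∩ τ' ∣ → c τ + c τ' ≤ 1) →
  (∀ k → 3 ≤ weight c k transversals) → ⊥
grid-lemma c c≤1 exclusive demanded =
  Soundness.refutation c c≤1 exclusive' (length transversals) transversals demanded refl
  where
  exclusive' : ∀ τ τ' → conflict τ τ' ≡ true → c τ + c τ' ≤ 1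
  exclusive' τ τ' clash with τ ≟ˢ τ' | clash
  ... | no τ≢τ' | big = exclusive τ τ' τ≢τ' (<ᵇ⇒< 1 _ (subst T (sym big) _))

_∈ᵇ_ : ∀ {n v} → Fin n → Block n v → Bool
a ∈ᵇ b = Vec.lookup (blk b) a

atPoint : ∀ {n v} → Fin v → Block n v → Bool
atPoint z b = does (pt b ≟ z)

atPoint⇒≡ : ∀ {n v} {z : Fin v} (b : Block n v) → atPoint z b ≡ true → pt b ≡ z
atPoint⇒≡ {z = z} b _ with pt b ≟ z
... | yes p = p

block-size : ∀ {v} (b : Block 12 v) → ∑ 12 (λ a → 𝟙 (a ∈ᵇ b)) ≡ 3
block-size b = trans (∑-card (blk b)) (proj₂ (proj₁ b))
  where
  ∑-card : ∀ {n} (B : Subset n) → ∑ n (λ a → 𝟙 (Vec.lookup B a)) ≡ ∣ B ∣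
  ∑-card []          = refl
  ∑-card (true ∷ B)  = cong suc (∑-card B)
  ∑-card (false ∷ B) = ∑-card B

block-at-one-point : ∀ {n v} (b : Block n v) → ∑ v (λ z → 𝟙 (atPoint z b)) ≡ 1
block-at-one-point {v = v} b = ∑-indicator v (pt b)
  where
  ∑-indicator : ∀ n (w : Fin n) → ∑ n (λ z → 𝟙 (does (w ≟ z))) ≡ 1
  ∑-indicator (suc n) zero    = cong suc (∑-zero n)
  ∑-indicator (suc n) (suc w) = ∑-indicator n w

length-filter : ∀ {A : Set} {P : Pred A 0ℓ} (P? : Decidable P) xs → length (filter P? xs) ≡ count (does ∘ P?) xs
length-filter P? []       = refl
length-filter P? (x ∷ xs) with does (P? x)
... | true  = cong suc (length-filter P? xs)
... | false = length-filter P? xs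

does-∈? : ∀ {n} (a : Fin n) (B : Subset n) → does (a ∈? B) ≡ Vec.lookup B a
does-∈? zero    (true ∷ B)  = refl
does-∈? zero    (false ∷ B) = refl
does-∈? (suc a) (s ∷ B)     = does-∈? a B

module Packing {v : ℕ} (bs : List (Block 12 v)) (packing : IsGenPacking bs) where

  pair-once : ∀ p q → p ≢ q → count (λ b → p ∈ᵇ b ∧ q ∈ᵇ b) bs ≤ 1
  pair-once p q p≢q = subst (_≤ 1)
    (trans (length-filter _ bs) (count-cong (λ b → cong₂ _∧_ (does-∈? p (blk b)) (does-∈? q (blk b))) bs))
    (proj₁ packing p q p≢q)

  once-per-class : ∀ a z → count (λ b → a ∈ᵇ b ∧ atPoint z b) bs ≤ 1
  once-per-class a z = subst (_≤ 1)
    (trans (length-filter _ bs) (count-cong (λ b → cong (_∧ atPoint z b) (does-∈? a (blk b))) bs))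
    (proj₂ packing a z)

  through-pair : ∀ (f : Block 12 v → Bool) p q → p ≢ q →
    (∀ {b} → b ∈ bs → f b ≡ true → p ∈ᵇ b ∧ q ∈ᵇ b ≡ true) → count f bs ≤ 1
  through-pair f p q p≢q through = ≤-trans (count-mono f _ bs through) (pair-once p q p≢q)

  classSize : Fin v → ℕ
  classSize z = count (atPoint z) bs

  degree : Fin 12 → ℕ
  degree a = count (a ∈ᵇ_) bs

  class-incidences : ∀ z → ∑ 12 (λ a → count (λ b → a ∈ᵇ b ∧ atPoint z b) bs) ≡ 3 * classSize z
  class-incidences z = double-counting 12 (λ b a → a ∈ᵇ b) 3 block-size (atPoint z) bs

  -- A class covers each of the twelve points at most once.
  classSize≤4 : ∀ z → classSize z ≤ 4
  classSize≤4 z = *-cancelˡ-≤ 3 (subst (_≤ 12) (class-incidences z)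
    (≤-trans (∑-mono 12 (λ a → once-per-class a z)) (≤-reflexive (∑-const 12 1))))

  -- Every block belongs to exactly one class.
  length≡∑classSize : length bs ≡ ∑ v classSize
  length≡∑classSize = sym (begin
    ∑ v classSize                                               ≡⟨ ∑-cong v (λ z → count-cong (λ b → sym (∧-identityʳ (atPoint z b))) bs) ⟩
    ∑ v (λ z → count (λ b → atPoint z b ∧ true) bs)             ≡⟨ double-counting v (λ b z → atPoint z b) 1 block-at-one-point (λ _ → true) bs ⟩
    1 * count (λ _ → true) bs                                   ≡⟨ trans (*-identityˡ _) (count-true bs) ⟩
    length bs                                                   ∎)
    where open ≡-Reasoning

  length≤4v : length bs ≤ 4 * v
  length≤4v = begin
    length bs                ≡⟨ length≡∑classSize ⟩
    ∑ v classSize            ≤⟨ ∑-mono v classSize≤4 ⟩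
    ∑ v (λ _ → 4)            ≡⟨ trans (∑-const v 4) (*-comm v 4) ⟩
    4 * v                    ∎
    where open ≤-Reasoning

  -- Counting the pairs through a: 3 · deg a = ∑_q (blocks through a and q) ≤ deg a + 11.
  degree≤5 : ∀ a → degree a ≤ 5
  degree≤5 a = ≤-pred (*-cancelˡ-< 2 (degree a) 6 (+-cancelˡ-< (degree a) _ _ (begin-strict
    3 * degree a                                             ≡⟨ sym (double-counting 12 (λ b q → q ∈ᵇ b) 3 block-size (a ∈ᵇ_) bs) ⟩
    ∑ 12 (λ q → count (λ b → q ∈ᵇ b ∧ a ∈ᵇ b) bs)            ≤⟨ ∑-except 11 _ a (λ q q≢a → pair-once q a q≢a) ⟩
    count (λ b → a ∈ᵇ b ∧ a ∈ᵇ b) bs + 11                   ≡⟨ cong (_+ 11) (count-cong (λ b → ∧-idem (a ∈ᵇ b)) bs) ⟩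
    degree a + 11                                            <⟨ +-monoʳ-< (degree a) (n<1+n 11) ⟩
    degree a + 2 * 6                                         ∎)))
    where open ≤-Reasoning

  ∑degree : ∑ 12 degree ≡ 3 * length bs
  ∑degree = begin
    ∑ 12 degree                                         ≡⟨ ∑-cong 12 (λ a → count-cong (λ b → sym (∧-identityʳ (a ∈ᵇ b))) bs) ⟩
    ∑ 12 (λ a → count (λ b → a ∈ᵇ b ∧ true) bs)        ≡⟨ double-counting 12 (λ b a → a ∈ᵇ b) 3 block-size (λ _ → true) bs ⟩
    3 * count (λ _ → true) bs                           ≡⟨ cong (3 *_) (count-true bs) ⟩
    3 * length bs                                       ∎
    where open ≡-Reasoning

  length≤20 : length bs ≤ 20
  length≤20 = *-cancelˡ-≤ 3 (subst (_≤ 60) ∑degree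
    (≤-trans (∑-mono 12 degree≤5) (≤-reflexive (∑-const 12 5))))

  degree≡5 : length bs ≡ 20 → ∀ a → degree a ≡ 5
  degree≡5 twenty = ∑-saturated 12 degree 5 degree≤5 (≤-reflexive (sym (trans ∑degree (cong (3 *_) twenty))))

opaque
  points : ∀ {v} (b : Block 12 v) → ThreeElements (blk b)
  points b = three-elements (blk b) (proj₂ (proj₁ b))


module Bound19 {v : ℕ} (bs : List (Block 12 v)) (packing : IsGenPacking bs) where

  open Packing bs packing

  share≤1 : ∀ {b b'} → b ∈ bs → b' ∈ bs → pt b ≢ pt b' → ∀ {p q} → p ≢ q →
    p ∈ᵇ b ≡ true → q ∈ᵇ b ≡ true → p ∈ᵇ b' ≡ true → q ∈ᵇ b' ≡ true → ⊥
  share≤1 b∈ b'∈ pt≢ {p} {q} p≢q pb qb pb' qb' = two≰one (≤-trans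
    (count-two (λ b → p ∈ᵇ b ∧ q ∈ᵇ b) bs b∈ b'∈ (pt≢ ∘ cong pt) (cong₂ _∧_ pb qb) (cong₂ _∧_ pb' qb'))
    (pair-once p q p≢q))

  -- A class with four blocks partitions the twelve points: its blocks, indexed by Fin 4,
  -- and for every point the index of the block containing it.
  module FullClass (z : Fin v) (full : classSize z ≡ 4) where

    members : List (Block 12 v)
    members = filterᵇ (atPoint z) bs

    size : length members ≡ 4
    size = trans (length-filter _ bs) full

    covered-once : ∀ a → count (λ b → a ∈ᵇ b ∧ atPoint z b) bs ≡ 1
    covered-once = ∑-saturated 12 _ 1 (λ a → once-per-class a z)
      (≤-reflexive (sym (trans (class-incidences z) (cong (3 *_) full))))

    opaque
      block : Fin 4 → Block 12 v
      block i = lookup members (Fin.cast (sym size) i)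

      block-member : ∀ i → block i ∈ bs × T (atPoint z (block i))
      block-member i = ∈-filter⁻ (T? ∘ atPoint z) {xs = bs} (∈-lookup (Fin.cast (sym size) i))

      block∈ : ∀ i → block i ∈ bs
      block∈ = proj₁ ∘ block-member

      block-at : ∀ i → pt (block i) ≡ z
      block-at i = atPoint⇒≡ (block i) (Equivalence.to T-≡ (proj₂ (block-member i)))

      position : ∀ a → ∃ λ (j : Fin (length members)) → a ∈ᵇ lookup members j ≡ true
      position a = count-witness-at (a ∈ᵇ_) members
        (≤-reflexive (sym (trans (count-filterᵇ (atPoint z) (a ∈ᵇ_) bs) (covered-once a))))

      line : Fin 12 → Fin 4
      line a = Fin.cast size (proj₁ (position a))

      line-∈ : ∀ a → a ∈ᵇ block (line a) ≡ true
      line-∈ a = subst (λ j → a ∈ᵇ lookup members j ≡ true)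
        (sym (Finₚ.cast-involutive (sym size) size _)) (proj₂ (position a))

      line-unique : ∀ a i → a ∈ᵇ block i ≡ true → line a ≡ i
      line-unique a i a∈ with line a ≟ i
      ... | yes same = same
      ... | no  differ = ⊥-elim (two≰one (begin
        2                                          ≤⟨ count-two-at (a ∈ᵇ_) members _ _ (differ ∘ cast-injective) (line-∈ a) a∈ ⟩
        count (a ∈ᵇ_) members                      ≡⟨ count-filterᵇ (atPoint z) (a ∈ᵇ_) bs ⟩
        count (λ b → a ∈ᵇ b ∧ atPoint z b) bs      ≤⟨ once-per-class a z ⟩
        1                                          ∎))
        where
        open ≤-Reasoning
        cast-injective : ∀ {i j} → Fin.cast (sym size) i ≡ Fin.cast (sym size) j → i ≡ j
        cast-injective {i} {j} eq = Finₚ.toℕ-injective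
          (trans (sym (Finₚ.toℕ-cast (sym size) i)) (trans (cong Fin.toℕ eq) (Finₚ.toℕ-cast (sym size) j)))

    lines-differ : ∀ {b} → b ∈ bs → pt b ≢ z → ∀ {p q} → p ≢ q →
      p ∈ᵇ b ≡ true → q ∈ᵇ b ≡ true → line p ≢ line q
    lines-differ b∈ pt≢ {p} {q} p≢q pb qb same =
      share≤1 b∈ (block∈ (line p)) (λ e → pt≢ (trans e (block-at _))) p≢q pb qb
        (line-∈ p) (subst (λ i → q ∈ᵇ block i ≡ true) (sym same) (line-∈ q))

  -- The blocks of
  -- x are the rows, those of y the columns of a 4 × 4 grid in which every point has a
  -- position; the remaining twelve blocks become transversals of that grid.
  module TwoFullClasses (x y : Fin v) (x≢y : x ≢ y) (full-x : classSize x ≡ 4)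
                        (full-y : classSize y ≡ 4) (twenty : length bs ≡ 20) where

    module X = FullClass x full-x
    module Y = FullClass y full-y

    pt-x≢pt-y : ∀ i j → pt (X.block i) ≢ pt (Y.block j)
    pt-x≢pt-y i j e = x≢y (trans (sym (X.block-at i)) (trans e (Y.block-at j)))

    same-position : ∀ p q → X.line p ≡ X.line q → Y.line p ≡ Y.line q → p ≡ q
    same-position p q same-row same-col with p ≟ q
    ... | yes p≡q = p≡q
    ... | no  p≢q = ⊥-elim (share≤1 (X.block∈ _) (Y.block∈ _) (pt-x≢pt-y _ _) p≢q
      (X.line-∈ p) (subst (λ i → q ∈ᵇ X.block i ≡ true) (sym same-row) (X.line-∈ q))
      (Y.line-∈ p) (subst (λ j → q ∈ᵇ Y.block j ≡ true) (sym same-col) (Y.line-∈ q)))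

    -- Column j has only three points, so some row contains none of them.
    opaque
      missed : Fin 4 → Fin 4
      missed j = proj₁ (avoid (X.line p₁) (X.line p₂) (X.line p₃))
        where open ThreeElements (points (Y.block j))

      missed-∉ : ∀ j a → a ∈ᵇ Y.block j ≡ true → X.line a ≢ missed j
      missed-∉ j a a∈ with only a a∈ | proj₂ (avoid (X.line p₁) (X.line p₂) (X.line p₃))
        where open ThreeElements (points (Y.block j))
      ... | inj₁ refl        | ≢p₁ , _   , _   = ≢p₁ ∘ sym
      ... | inj₂ (inj₁ refl) | _   , ≢p₂ , _   = ≢p₂ ∘ sym
      ... | inj₂ (inj₂ refl) | _   , _   , ≢p₃ = ≢p₃ ∘ sym

    -- Different columns miss different rows: otherwise the three points of the missed row
    -- would lie in the two remaining columns.
    missed-injective : ∀ {j j'} → missed j ≡ missed j' → j ≡ j'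
    missed-injective {j} {j'} same with j ≟ j'
    ... | yes j≡j' = j≡j'
    ... | no  j≢j' = ⊥-elim (no-three-avoiding-two (Y.line p₁) (Y.line p₂) (Y.line p₃) j j'
          (differ p₁≢p₂ p₁∈ p₂∈) (differ p₁≢p₃ p₁∈ p₃∈) (differ p₂≢p₃ p₂∈ p₃∈) j≢j'
          (avoids j refl p₁ p₁∈) (avoids j refl p₂ p₂∈) (avoids j refl p₃ p₃∈)
          (avoids j' same p₁ p₁∈) (avoids j' same p₂ p₂∈) (avoids j' same p₃ p₃∈))
      where
      missedRow : Block 12 v
      missedRow = X.block (missed j)
      open ThreeElements (points missedRow)
      differ : ∀ {p q} → p ≢ q → p ∈ᵇ missedRow ≡ true → q ∈ᵇ missedRow ≡ true → Y.line p ≢ Y.line q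
      differ = Y.lines-differ (X.block∈ _) (λ e → x≢y (trans (sym (X.block-at _)) e))
      avoids : ∀ k → missed j ≡ missed k → ∀ p → p ∈ᵇ missedRow ≡ true → Y.line p ≢ k
      avoids k eq p p∈ refl = missed-∉ (Y.line p) p (Y.line-∈ p) (trans (X.line-unique p _ p∈) eq)

    -- Relabelling the columns by the rows they miss puts every point off the diagonal.
    column : Fin 12 → Fin 4
    column a = missed (Y.line a)

    row≢column : ∀ a → X.line a ≢ column a
    row≢column a = missed-∉ (Y.line a) a (Y.line-∈ a)

    cellOf : Fin 12 → Fin 12
    cellOf a = cellAt (X.line a) (column a)

    cellOf-row : ∀ a → row (cellOf a) ≡ X.line a
    cellOf-row a = proj₁ (cellAt-row-col _ _ (row≢column a))

    cellOf-col : ∀ a → col (cellOf a) ≡ column a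
    cellOf-col a = proj₂ (cellAt-row-col _ _ (row≢column a))

    cellOf-injective : ∀ {p q} → cellOf p ≡ cellOf q → p ≡ q
    cellOf-injective {p} {q} same = same-position p q
      (trans (sym (cellOf-row p)) (trans (cong row same) (cellOf-row q)))
      (missed-injective (trans (sym (cellOf-col p)) (trans (cong col same) (cellOf-col q))))

    -- Twelve points in twelve cells: every cell holds exactly one point.
    pointAt : Fin 12 → Fin 12
    pointAt k = proj₁ (injective⇒onto cellOf cellOf-injective k)

    cellOf-pointAt : ∀ k → cellOf (pointAt k) ≡ k
    cellOf-pointAt k = proj₂ (injective⇒onto cellOf cellOf-injective k)

    pointAt-cellOf : ∀ a → pointAt (cellOf a) ≡ a
    pointAt-cellOf a = cellOf-injective (cellOf-pointAt (cellOf a))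

    other : Block 12 v → Bool
    other b = not (atPoint x b) ∧ not (atPoint y b)

    other⇒ : ∀ b → other b ≡ true → pt b ≢ x × pt b ≢ y
    other⇒ b o with pt b ≟ x | pt b ≟ y | o
    ... | no ≢x | no ≢y | _ = ≢x , ≢y

    image : Block 12 v → Subset 12
    image b = triple (cellOf p₁) (cellOf p₂) (cellOf p₃)
      where open ThreeElements (points b)

    image⇒∈ : ∀ b k → Vec.lookup (image b) k ≡ true → pointAt k ∈ᵇ b ≡ true
    image⇒∈ b k k∈ = occupied (triple-members (cellOf p₁) (cellOf p₂) (cellOf p₃) k k∈)
      where
      open ThreeElements (points b)
      at : ∀ {p} → p ∈ᵇ b ≡ true → k ≡ cellOf p → pointAt k ∈ᵇ b ≡ true
      at {p} p∈ k≡ = subst (λ a → a ∈ᵇ b ≡ true) (sym (trans (cong pointAt k≡) (pointAt-cellOf p))) p∈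
      occupied : k ≡ cellOf p₁ ⊎ k ≡ cellOf p₂ ⊎ k ≡ cellOf p₃ → pointAt k ∈ᵇ b ≡ true
      occupied (inj₁ k≡)        = at p₁∈ k≡
      occupied (inj₂ (inj₁ k≡)) = at p₂∈ k≡
      occupied (inj₂ (inj₂ k≡)) = at p₃∈ k≡

    ∈⇒image : ∀ b a → a ∈ᵇ b ≡ true → Vec.lookup (image b) (cellOf a) ≡ true
    ∈⇒image b a a∈ = triple-∋ (cellOf p₁) (cellOf p₂) (cellOf p₃) (cellOf a) (which (only a a∈))
      where
      open ThreeElements (points b)
      which : a ≡ p₁ ⊎ a ≡ p₂ ⊎ a ≡ p₃ → cellOf a ≡ cellOf p₁ ⊎ cellOf a ≡ cellOf p₂ ⊎ cellOf a ≡ cellOf p₃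
      which (inj₁ a≡)        = inj₁ (cong cellOf a≡)
      which (inj₂ (inj₁ a≡)) = inj₂ (inj₁ (cong cellOf a≡))
      which (inj₂ (inj₂ a≡)) = inj₂ (inj₂ (cong cellOf a≡))

    -- A block outside the two classes meets every row and every column at most once, so
    -- its image is a transversal.
    image-listed : ∀ {b} → b ∈ bs → other b ≡ true → image b ∈ transversals
    image-listed {b} b∈ o = transversal-listed _ _ _
      ( (rows p₁≢p₂ p₁∈ p₂∈ , rows p₁≢p₃ p₁∈ p₃∈ , rows p₂≢p₃ p₂∈ p₃∈)
      , (cols p₁≢p₂ p₁∈ p₂∈ , cols p₁≢p₃ p₁∈ p₃∈ , cols p₂≢p₃ p₂∈ p₃∈))
      where
      open ThreeElements (points b)
      rows : ∀ {p q} → p ≢ q → p ∈ᵇ b ≡ true → q ∈ᵇ b ≡ true → row (cellOf p) ≢ row (cellOf q)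
      rows {p} {q} p≢q p∈ q∈ same = X.lines-differ b∈ (proj₁ (other⇒ b o)) p≢q p∈ q∈
        (trans (sym (cellOf-row p)) (trans same (cellOf-row q)))
      cols : ∀ {p q} → p ≢ q → p ∈ᵇ b ≡ true → q ∈ᵇ b ≡ true → col (cellOf p) ≢ col (cellOf q)
      cols {p} {q} p≢q p∈ q∈ same = Y.lines-differ b∈ (proj₂ (other⇒ b o)) p≢q p∈ q∈
        (missed-injective (trans (sym (cellOf-col p)) (trans same (cellOf-col q))))

    ofType : Subset 12 → Block 12 v → Bool
    ofType τ b = other b ∧ does (image b ≟ˢ τ)

    ofType⇒ : ∀ τ b → ofType τ b ≡ true → other b ≡ true × image b ≡ τ
    ofType⇒ τ b t with image b ≟ˢ τ | ∧-true {other b} t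
    ... | yes same | o , _ = o , same

    multiplicity : Subset 12 → ℕ
    multiplicity τ = count (ofType τ) bs

    through-cells : ∀ (f : Block 12 v → Bool) k k' → k ≢ k' →
      (∀ {b} → b ∈ bs → f b ≡ true → Vec.lookup (image b) k ≡ true × Vec.lookup (image b) k' ≡ true) →
      count f bs ≤ 1
    through-cells f k k' k≢k' through = through-pair f (pointAt k) (pointAt k') pointAt≢
      (λ {b} b∈ fb → cong₂ _∧_ (image⇒∈ b k (proj₁ (through b∈ fb))) (image⇒∈ b k' (proj₂ (through b∈ fb))))
      where
      pointAt≢ : pointAt k ≢ pointAt k'
      pointAt≢ same = k≢k' (trans (sym (cellOf-pointAt k)) (trans (cong cellOf same) (cellOf-pointAt k')))

    -- Two blocks with the same image share its cells, hence two points.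
    multiplicity≤1 : ∀ τ → multiplicity τ ≤ 1
    multiplicity≤1 τ with multiplicity τ in m | count-witness (ofType τ) bs
    ... | zero  | _       = z≤n
    ... | suc _ | witness with witness (s≤s z≤n)
    ...   | b₀ , b₀∈ , t₀ = subst (_≤ 1) m (through-cells (ofType τ) (cellOf p₁) (cellOf p₂)
            (p₁≢p₂ ∘ cellOf-injective) in-τ)
      where
      open ThreeElements (points b₀)
      τ≡ : image b₀ ≡ τ
      τ≡ = proj₂ (ofType⇒ τ b₀ t₀)
      in-τ : ∀ {b} → b ∈ bs → ofType τ b ≡ true →
        Vec.lookup (image b) (cellOf p₁) ≡ true × Vec.lookup (image b) (cellOf p₂) ≡ true
      in-τ {b} _ t rewrite proj₂ (ofType⇒ τ b t) | sym τ≡ = ∈⇒image b₀ p₁ p₁∈ , ∈⇒image b₀ p₂ p₂∈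

    exclusive : ∀ τ τ' → τ ≢ τ' → 2 ≤ ∣ τ ∩ τ' ∣ → multiplicity τ + multiplicity τ' ≤ 1
    exclusive τ τ' τ≢τ' shared with two-members (τ ∩ τ') shared
    ... | k , k' , k≢k' , k∈ , k'∈ = begin
      count (ofType τ) bs + count (ofType τ') bs    ≡⟨ sym (count-∨ (ofType τ) (ofType τ') bs disjoint) ⟩
      count (λ b → ofType τ b ∨ ofType τ' b) bs      ≤⟨ through-cells _ k k' k≢k' through ⟩
      1                                              ∎
      where
      open ≤-Reasoning
      in-both : ∀ {i} → Vec.lookup (τ ∩ τ') i ≡ true → Vec.lookup τ i ≡ true × Vec.lookup τ' i ≡ true
      in-both {i} i∈ = ∧-true (trans (sym (lookup-zipWith _∧_ i τ τ')) i∈)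
      disjoint : ∀ b → ofType τ b ∧ ofType τ' b ≡ false
      disjoint b with ofType τ b in t | ofType τ' b in t'
      ... | false | _     = refl
      ... | true  | false = refl
      ... | true  | true  = ⊥-elim (τ≢τ' (trans (sym (proj₂ (ofType⇒ τ b t))) (proj₂ (ofType⇒ τ' b t'))))
      through : ∀ {b} → b ∈ bs → (ofType τ b ∨ ofType τ' b) ≡ true →
        Vec.lookup (image b) k ≡ true × Vec.lookup (image b) k' ≡ true
      through {b} _ t with ofType τ b in tτ
      ... | true  rewrite proj₂ (ofType⇒ τ b tτ) = proj₁ (in-both k∈) , proj₁ (in-both k'∈)
      ... | false rewrite proj₂ (ofType⇒ τ' b t) = proj₂ (in-both k∈) , proj₂ (in-both k'∈)

    othersThrough : Fin 12 → Block 12 v → Bool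
    othersThrough a b = not (atPoint y b) ∧ (not (atPoint x b) ∧ a ∈ᵇ b)

    -- A point lies in five blocks, at most one from each full class.
    three-others : ∀ a → 3 ≤ count (othersThrough a) bs
    three-others a = +-cancelˡ-≤ 2 3 _ (begin
      5                                                                  ≡⟨ sym (degree≡5 twenty a) ⟩
      count (a ∈ᵇ_) bs                                                   ≡⟨ count-split (atPoint x) (a ∈ᵇ_) bs ⟩
      count in-x bs + count (λ b → not (atPoint x b) ∧ a ∈ᵇ b) bs        ≡⟨ cong (count in-x bs +_) (count-split (atPoint y) _ bs) ⟩
      count in-x bs + (count in-y bs + count (othersThrough a) bs)       ≤⟨ +-mono-≤ in-x-once (+-monoˡ-≤ _ in-y-once) ⟩
      1 + (1 + count (othersThrough a) bs)                               ∎)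
      where
      open ≤-Reasoning
      in-x in-y : Block 12 v → Bool
      in-x b = atPoint x b ∧ a ∈ᵇ b
      in-y b = atPoint y b ∧ (not (atPoint x b) ∧ a ∈ᵇ b)
      in-x-once : count in-x bs ≤ 1
      in-x-once = ≤-trans (≤-reflexive (count-cong (λ b → ∧-comm (atPoint x b) (a ∈ᵇ b)) bs)) (once-per-class a x)
      in-y-once : count in-y bs ≤ 1
      in-y-once = ≤-trans (count-mono in-y (λ b → a ∈ᵇ b ∧ atPoint y b) bs swap) (once-per-class a y)
        where
        swap : ∀ {b} → b ∈ bs → in-y b ≡ true → a ∈ᵇ b ∧ atPoint y b ≡ true
        swap {b} _ t = let (at-y , rest) = ∧-true {atPoint y b} t in cong₂ _∧_ (proj₂ (∧-true {not (atPoint x b)} rest)) at-y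

    -- Each block counted there has a transversal image through the cell of a.
    others≤weight : ∀ k → count (othersThrough (pointAt k)) bs ≤ weight multiplicity k transversals
    others≤weight k = begin
      count (othersThrough (pointAt k)) bs                                       ≤⟨ count≤sumOver _ _ transversals bs typed ⟩
      sumOver (λ τ → count (λ b → Vec.lookup τ k ∧ ofType τ b) bs) transversals  ≡⟨ sumOver-cong weighted transversals ⟩
      weight multiplicity k transversals                                         ∎
      where
      open ≤-Reasoning
      typed : ∀ {b} → b ∈ bs → othersThrough (pointAt k) b ≡ true →
        Any (λ τ → Vec.lookup τ k ∧ ofType τ b ≡ true) transversals
      typed {b} b∈ t = Any.map (λ img≡τ → subst (λ σ → Vec.lookup σ k ∧ ofType σ b ≡ true) img≡τ (cong₂ _∧_ in-image own-type))
                               (image-listed b∈ o)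
        where
        not-y = ∧-true {not (atPoint y b)} t
        not-x = ∧-true {not (atPoint x b)} (proj₂ not-y)
        o : other b ≡ true
        o = cong₂ _∧_ (proj₁ not-x) (proj₁ not-y)
        in-image : Vec.lookup (image b) k ≡ true
        in-image = subst (λ c → Vec.lookup (image b) c ≡ true) (cellOf-pointAt k) (∈⇒image b (pointAt k) (proj₂ not-x))
        own-type : ofType (image b) b ≡ true
        own-type = cong₂ _∧_ o (dec-true (image b ≟ˢ image b) refl)
      weighted : ∀ τ → count (λ b → Vec.lookup τ k ∧ ofType τ b) bs ≡ (if Vec.lookup τ k then multiplicity τ else 0)
      weighted τ with Vec.lookup τ k
      ... | true  = refl
      ... | false = count-false bs

    demand : ∀ k → 3 ≤ weight multiplicity k transversals
    demand k = ≤-trans (three-others (pointAt k)) (others≤weight k)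

    impossible : ⊥
    impossible = grid-lemma multiplicity multiplicity≤1 exclusive demand

  -- With at most six points in X₂ there are at most 19 blocks: either at most one class
  -- is full, and then there are at most 4 + 3 · 5 blocks, or two classes are full, and
  -- then twenty blocks are impossible.
  length≤19 : v ≤ 6 → length bs ≤ 19
  length≤19 v≤6 with ∑-one-full v classSize 3 classSize≤4
  ... | inj₁ one-full = begin
    length bs          ≡⟨ length≡∑classSize ⟩
    ∑ v classSize      ≤⟨ one-full ⟩
    v * 3 + 1          ≤⟨ +-monoˡ-≤ 1 (*-monoˡ-≤ 3 v≤6) ⟩
    19                 ∎
    where open ≤-Reasoning
  ... | inj₂ (x , y , x≢y , full-x , full-y) with length bs ≟ℕ 20
  ...   | yes twenty = ⊥-elim (TwoFullClasses.impossible x y x≢y full-x full-y twenty)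
  ...   | no  ≢20    = ≤-pred (≤∧≢⇒< length≤20 ≢20)

isGenPacking? : ∀ {n v} (bs : List (Block n v)) → Dec (IsGenPacking bs)
isGenPacking? bs =
  (Finₚ.all? λ p → Finₚ.all? λ q → ¬? (p ≟ q) →-dec
     (length (filter (λ b → (p ∈? blk b) ×-dec (q ∈? blk b)) bs) ≤? 1))
  ×-dec
  (Finₚ.all? λ a → Finₚ.all? λ x →
     length (filter (λ b → (a ∈? blk b) ×-dec (pt b ≟ x)) bs) ≤? 1)

relabel : ∀ {n v w} → (Fin v → Fin w) → Block n v → Block n w
relabel f (B , x) = B , f x

relabel-packing : ∀ {n v w} (f : Fin v → Fin w) → (∀ {x y} → f x ≡ f y → x ≡ y) →
  (bs : List (Block n v)) → IsGenPacking bs → IsGenPacking (map (relabel f) bs)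
relabel-packing f injective bs (pairs , classes) = pairs′ , classes′
  where
  pairs′ : ∀ p q → p ≢ q → length (filter (λ b → (p ∈? blk b) ×-dec (q ∈? blk b)) (map (relabel f) bs)) ≤ 1
  pairs′ p q p≢q = subst (_≤ 1)
    (sym (trans (length-filter _ (map (relabel f) bs)) (trans (count-map _ (relabel f) bs) (sym (length-filter _ bs)))))
    (pairs p q p≢q)
  classes′ : ∀ a x′ → length (filter (λ b → (a ∈? blk b) ×-dec (pt b ≟ x′)) (map (relabel f) bs)) ≤ 1
  classes′ a x′ rewrite length-filter (λ b → (a ∈? blk b) ×-dec (pt b ≟ x′)) (map (relabel f) bs)
                      | count-map (λ b → does ((a ∈? blk b) ×-dec (pt b ≟ x′))) (relabel f) bs
    with Finₚ.any? (λ x → f x ≟ x′)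
  ... | yes (x , refl) = subst (_≤ 1)
          (trans (length-filter _ bs) (count-cong (λ b → cong (does (a ∈? blk b) ∧_) (does-⇔ (mk⇔ (cong f) injective) (pt b ≟ x) (f (pt b) ≟ f x))) bs))
          (classes a x)
  ... | no  outside = ≤-trans (≤-reflexive (trans (count-cong none bs) (count-false bs))) z≤n
    where
    none : ∀ b → does (a ∈? blk b) ∧ does (f (pt b) ≟ x′) ≡ false
    none b = trans (cong (does (a ∈? blk b) ∧_) (dec-false (f (pt b) ≟ x′) (λ e → outside (pt b , e)))) (∧-zeroʳ _)

blockOf : ∀ {v} (i j k : Fin 12) (x : Fin v) {three : True (∣ triple i j k ∣ ≟ℕ 3)} → Block 12 v
blockOf i j k x {three} = (triple i j k , toWitness three) , x

-- Four parallel classes of triples on twelve points, no two triples sharing a pair.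
parallelClass : ∀ {v} → Fin 4 → Fin v → List (Block 12 v)
parallelClass zero x =
  blockOf (# 0) (# 7) (# 11) x ∷ blockOf (# 1) (# 2) (# 8) x ∷ blockOf (# 3) (# 5) (# 9) x ∷ blockOf (# 4) (# 6) (# 10) x ∷ []
parallelClass (suc zero) x =
  blockOf (# 0) (# 1) (# 4) x ∷ blockOf (# 2) (# 7) (# 9) x ∷ blockOf (# 3) (# 6) (# 11) x ∷ blockOf (# 5) (# 8) (# 10) x ∷ []
parallelClass (suc (suc zero)) x =
  blockOf (# 0) (# 6) (# 8) x ∷ blockOf (# 1) (# 5) (# 7) x ∷ blockOf (# 2) (# 3) (# 4) x ∷ blockOf (# 9) (# 10) (# 11) x ∷ []
parallelClass (suc (suc (suc zero))) x =
  blockOf (# 0) (# 2) (# 10) x ∷ blockOf (# 1) (# 6) (# 9) x ∷ blockOf (# 3) (# 7) (# 8) x ∷ blockOf (# 4) (# 5) (# 11) x ∷ []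

resolvable : ∀ {v} → (Fin v → Fin 4) → List (Block 12 v)
resolvable {v} cls = concatMap (λ x → parallelClass (cls x) x) (allFin v)

packing19 : List (Block 12 5)
packing19 = map (relabel Fin.inject₁) (resolvable (λ x → x))
  ++ blockOf (# 1) (# 3) (# 10) (# 4) ∷ blockOf (# 2) (# 5) (# 6) (# 4) ∷ blockOf (# 4) (# 8) (# 9) (# 4) ∷ []

packing20 : List (Block 12 7)
packing20 =
  blockOf (# 0) (# 2) (# 4) (# 0) ∷ blockOf (# 1) (# 3) (# 7) (# 0) ∷ blockOf (# 5) (# 6) (# 10) (# 0) ∷
  blockOf (# 0) (# 3) (# 5) (# 1) ∷ blockOf (# 1) (# 2) (# 6) (# 1) ∷ blockOf (# 4) (# 7) (# 9) (# 1) ∷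
  blockOf (# 0) (# 6) (# 8) (# 2) ∷ blockOf (# 2) (# 7) (# 11) (# 2) ∷ blockOf (# 3) (# 4) (# 10) (# 2) ∷
  blockOf (# 0) (# 7) (# 10) (# 3) ∷ blockOf (# 2) (# 5) (# 9) (# 3) ∷ blockOf (# 3) (# 8) (# 11) (# 3) ∷
  blockOf (# 0) (# 9) (# 11) (# 4) ∷ blockOf (# 1) (# 4) (# 8) (# 4) ∷
  blockOf (# 1) (# 5) (# 11) (# 5) ∷ blockOf (# 2) (# 8) (# 10) (# 5) ∷ blockOf (# 3) (# 6) (# 9) (# 5) ∷
  blockOf (# 1) (# 9) (# 10) (# 6) ∷ blockOf (# 4) (# 6) (# 11) (# 6) ∷ blockOf (# 5) (# 7) (# 8) (# 6) ∷ []

resolvable-packing : ∀ v (v≤4 : v ≤ 4) →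
  IsGenPacking (resolvable (λ x → Fin.inject≤ x v≤4)) × length (resolvable (λ x → Fin.inject≤ x v≤4)) ≡ 4 * v
resolvable-packing 0 v≤4 = toWitness {a? = isGenPacking? (resolvable {0} (λ x → Fin.inject≤ x v≤4))} _ , refl
resolvable-packing 1 v≤4 = toWitness {a? = isGenPacking? (resolvable {1} (λ x → Fin.inject≤ x v≤4))} _ , refl
resolvable-packing 2 v≤4 = toWitness {a? = isGenPacking? (resolvable {2} (λ x → Fin.inject≤ x v≤4))} _ , refl
resolvable-packing 3 v≤4 = toWitness {a? = isGenPacking? (resolvable {3} (λ x → Fin.inject≤ x v≤4))} _ , refl
resolvable-packing 4 v≤4 = toWitness {a? = isGenPacking? (resolvable {4} (λ x → Fin.inject≤ x v≤4))} _ , refl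
resolvable-packing (suc (suc (suc (suc (suc _))))) (s≤s (s≤s (s≤s (s≤s ()))))

packing19-ok : IsGenPacking packing19
packing19-ok = toWitness {a? = isGenPacking? packing19} _

packing20-ok : IsGenPacking packing20
packing20-ok = toWitness {a? = isGenPacking? packing20} _

lemma5p8 : (v₂ : ℕ) → 1 ≤ v₂ →
    ((v₂ ≤ 4 → IsD 12 v₂ (4 * v₂))
     × ((v₂ ≡ 5 ⊎ v₂ ≡ 6) → IsD 12 v₂ 19)
     × (7 ≤ v₂ → IsD 12 v₂ 20))
lemma5p8 v₂ _ = small , middle , large
  where
  small : v₂ ≤ 4 → IsD 12 v₂ (4 * v₂)
  small v≤4 = (resolvable (λ x → Fin.inject≤ x v≤4) , resolvable-packing v₂ v≤4) , Packing.length≤4v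
  middle : v₂ ≡ 5 ⊎ v₂ ≡ 6 → IsD 12 v₂ 19
  middle (inj₁ refl) = (packing19 , packing19-ok , refl) , λ bs packing → Bound19.length≤19 bs packing (n≤1+n 5)
  middle (inj₂ refl) = (map (relabel Fin.inject₁) packing19
                       , relabel-packing Fin.inject₁ Finₚ.inject₁-injective packing19 packing19-ok
                       , length-map (relabel Fin.inject₁) packing19)
                     , λ bs packing → Bound19.length≤19 bs packing ≤-refl
  large : 7 ≤ v₂ → IsD 12 v₂ 20
  large 7≤v = (map (relabel embed) packing20 , relabel-packing embed (Finₚ.inject≤-injective 7≤v 7≤v _ _) packing20 packing20-ok
                 , length-map (relabel embed) packing20)
            , Packing.length≤20
    where
    embed : Fin 7 → Fin v₂
    embed x = Fin.inject≤ x 7≤v
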